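{- Let $H=(V,E)$ be a finite, simple, connected graph and let $T$ be a spanning tree of $H$ that is a solution of the MSTCI problem for $H$. Then for every edge $e\in E$ not in $T$, the graph $G=(V,E\setminus\{e\})$ satisfies $\cap(G)\le\cap(H)$.
   Context: For a spanning tree $T$ of a graph $H$, edges of $H$ not in $T$ are cycle-edges; a cycle-edge $f=(x,y)$ determines the tree-cycle formed by the unique $x$–$y$ path in $T$ together with $f$. $\cap_H(T)$ is the number of unordered pairs of distinct cycle-edges whose tree-cycles share at least one edge. The MSTCI problem for $H$ asks for a spanning tree minimizing $\cap_H(T)$; such a tree is a solution, and $\cap(H)$ denotes the minimum value. -}

module Defs where

open import Data.Nat using (ℕ; _≤_)
open import Data.Nat.Properties using (≤-irrelevant)
open import Data.Fin using (Fin; _<_)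
open import Data.Fin.Properties using () renaming (_≟_ to _≟F_)
open import Data.Bool using (Bool; true; false; _∧_; not)
open import Data.List using (List; []; _∷_; length)
open import Data.List.Membership.Propositional using (_∈_)
open import Data.List.Relation.Unary.Unique.Propositional using (Unique)
open import Data.Product using (Σ; ∃; ∃-syntax; _×_; _,_)
open import Data.Sum using (_⊎_)
open import Data.Empty using (⊥)
open import Relation.Nullary using (¬_; Dec; yes; no)
open import Relation.Nullary.Decidable using (⌊_⌋)
open import Relation.Binary.PropositionalEquality using (_≡_; refl)
open import Function.Bundles using (_⇔_)

-- A (potential) edge is an unordered pair {src, tgt} of distinct vertices,
-- stored canonically with src < tgt.  Hence graphs are automatically simple.
record Edge (n : ℕ) : Set where
  constructor edge
  field
    src : Fin n
    tgt : Fin n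
    ord : src < tgt
open Edge public

_≟ₑ_ : ∀ {n} (d e : Edge n) → Dec (d ≡ e)
edge s t p ≟ₑ edge s' t' p' with s ≟F s' | t ≟F t'
... | yes refl | yes refl with ≤-irrelevant p p'
...   | refl = yes refl
edge s t p ≟ₑ edge s' t' p' | no ne | _ = no λ { refl → ne refl }
edge s t p ≟ₑ edge s' t' p' | yes _ | no ne = no λ { refl → ne refl }

Graph : ℕ → Set
Graph n = Edge n → Bool

_─_ : ∀ {n} → Graph n → Edge n → Graph n
(H ─ e) d = H d ∧ not ⌊ d ≟ₑ e ⌋

Joins : ∀ {n} → Edge n → Fin n → Fin n → Set
Joins e u v = (src e ≡ u × tgt e ≡ v) ⊎ (src e ≡ v × tgt e ≡ u)

Adj : ∀ {n} → Graph n → Fin n → Fin n → Set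
Adj G u v = ∃[ e ] (G e ≡ true × Joins e u v)

data Walk {n} (G : Graph n) : Fin n → Fin n → List (Fin n) → Set where
  here : ∀ {x} → Walk G x x (x ∷ [])
  step : ∀ {x y z vs} → Adj G x y → Walk G y z vs → Walk G x z (x ∷ vs)

Path : ∀ {n} → Graph n → Fin n → Fin n → List (Fin n) → Set
Path G x y vs = Walk G x y vs × Unique vs

Uses : ∀ {n} → Edge n → List (Fin n) → Set
Uses e (u ∷ v ∷ vs) = Joins e u v ⊎ Uses e (v ∷ vs)
Uses e _ = ⊥

Connected : ∀ {n} → Graph n → Set
Connected G = ∀ x y → ∃[ vs ] Walk G x y vs

HasCycle : ∀ {n} → Graph n → Set
HasCycle G = ∃[ x ] ∃[ y ] ∃[ vs ] (Path G x y vs × 3 ≤ length vs × Adj G y x)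

Acyclic : ∀ {n} → Graph n → Set
Acyclic G = ¬ HasCycle G

SpanningTree : ∀ {n} → Graph n → Graph n → Set
SpanningTree H T = (∀ d → T d ≡ true → H d ≡ true) × Connected T × Acyclic T

CycleEdge : ∀ {n} → Graph n → Graph n → Edge n → Set
CycleEdge H T f = H f ≡ true × T f ≡ false

InTreeCycle : ∀ {n} → Graph n → Edge n → Edge n → Set
InTreeCycle T f d = d ≡ f ⊎ ∃[ vs ] (Path T (src f) (tgt f) vs × Uses d vs)

-- strict total order on edges (lexicographic), used to count unordered pairs once
_<ₑ_ : ∀ {n} → Edge n → Edge n → Set
d <ₑ e = src d < src e ⊎ (src d ≡ src e × tgt d < tgt e)

-- unordered pairs {f, g} (represented with f <ₑ g) of distinct cycle-edges
-- whose tree-cycles share at least one edge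
SharePair : ∀ {n} → Graph n → Graph n → Edge n × Edge n → Set
SharePair H T (f , g) =
  CycleEdge H T f × CycleEdge H T g × f <ₑ g ×
  ∃[ d ] (InTreeCycle T f d × InTreeCycle T g d)

Card : {A : Set} → (A → Set) → ℕ → Set
Card {A} P k = ∃[ L ] (Unique L × (∀ (a : A) → (a ∈ L) ⇔ P a) × length L ≡ k)

Cap : ∀ {n} → Graph n → Graph n → ℕ → Set
Cap H T k = Card (SharePair H T) k

IsSolution : ∀ {n} → Graph n → Graph n → Set
IsSolution H T = SpanningTree H T ×
  ∃[ c ] (Cap H T c × (∀ T' k → SpanningTree H T' → Cap H T' k → c ≤ k))

MinCap : ∀ {n} → Graph n → ℕ → Set
MinCap H m = (∃[ T ] (SpanningTree H T × Cap H T m)) ×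
  (∀ T k → SpanningTree H T → Cap H T k → m ≤ k)

-- T avoids e, so it is still a spanning tree of H ─ e with the same
-- tree-cycles, and the cycle-edges of H ─ e are cycle-edges of H; hence every
-- pair counted by ∩_{H ─ e}(T) is counted by ∩_H(T) = ∩(H), and
-- ∩(H ─ e) ≤ ∩_{H ─ e}(T) ≤ ∩(H).  That the minimum ∩(H ─ e) is attained
-- at all is constructive content here: all notions involved are decidable,
-- and up to pointwise equality there are only finitely many graphs on Fin n.
module Submission where

open import Defs
open import Data.Nat using (ℕ; zero; suc; _≤_; z≤n; s≤s)
open import Data.Nat.Properties using (≤-trans; ≤-antisym; ≤-irrelevant; _≤?_; module ≤-Reasoning)
open import Data.Bool using (true; false; _∧_)
open import Data.Bool.Properties using (¬-not) renaming (_≟_ to _≟ᵇ_)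
open import Data.Product using (∃; ∃-syntax; _×_; _,_; proj₁; proj₂)
open import Data.Product.Properties using (≡-dec)
open import Data.Sum using (inj₁; inj₂)
open import Data.Empty using (⊥-elim)
open import Data.List using (List; []; _∷_; _++_; length; map; concatMap; filter; allFin; cartesianProduct; deduplicate)
open import Data.List.Properties using (length-++-sucʳ; length-tabulate)
open import Data.List.Membership.Propositional using (_∈_; lose)
open import Data.List.Membership.Propositional.Properties
  using (∈-∃++; ∈-++⁺ˡ; ∈-++⁺ʳ; ∈-++⁻; ∈-map⁺; ∈-concatMap⁺; ∈-filter⁺; ∈-filter⁻; ∈-allFin; ∈-cartesianProduct⁺; ∈-deduplicate⁺)
open import Data.List.Relation.Unary.Any as Any using (here; there)
open import Data.List.Relation.Unary.All as All using (All; [])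
open import Data.List.Relation.Unary.All.Properties using (all-filter)
open import Data.List.Relation.Unary.AllPairs using ([]; _∷_)
open import Data.List.Relation.Unary.Unique.Propositional using (Unique)
open import Data.List.Relation.Unary.Unique.Propositional.Properties using (filter⁺)
open import Data.List.Relation.Unary.Unique.DecPropositional.Properties using (deduplicate-!)
open import Data.List.Extrema.Nat using (argmin; argmin-all; f[argmin]≤f[⊤]; f[argmin]≤f[xs])
open import Data.Fin using (Fin) renaming (_<_ to _<ᶠ_)
open import Data.Fin.Properties as Fin using (_<?_) renaming (_≟_ to _≟ᶠ_)
open import Function using (_∘_; id)
open import Function.Bundles using (mk⇔; Equivalence)
open import Relation.Nullary using (Dec; yes; no; does; ¬?; contradiction)
open import Relation.Nullary.Decidable using (_×-dec_; _⊎-dec_; _→-dec_; map′)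
open import Relation.Unary using (Decidable; IUniversal; _⇒_)
open import Relation.Binary.Definitions using (DecidableEquality)
open import Relation.Binary.PropositionalEquality using (_≡_; refl; sym; trans; cong; subst; _≗_)

private
  variable
    A : Set
    k k′ : ℕ

length-≤-of-unique-⊆ : {xs ys : List A} → Unique xs → (∀ {a} → a ∈ xs → a ∈ ys) → length xs ≤ length ys
length-≤-of-unique-⊆ {xs = []} _ _ = z≤n
length-≤-of-unique-⊆ {xs = x ∷ xs} (x∉xs ∷ !xs) xs⊆ys
  with ys₁ , ys₂ , refl ← ∈-∃++ (xs⊆ys (here refl)) = begin
    suc (length xs)           ≤⟨ s≤s (length-≤-of-unique-⊆ !xs xs⊆ys₁++ys₂) ⟩
    suc (length (ys₁ ++ ys₂)) ≡⟨ sym (length-++-sucʳ ys₁ x ys₂) ⟩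
    length (ys₁ ++ x ∷ ys₂)   ∎
  where
  open ≤-Reasoning
  xs⊆ys₁++ys₂ : ∀ {a} → a ∈ xs → a ∈ ys₁ ++ ys₂
  xs⊆ys₁++ys₂ a∈xs with ∈-++⁻ ys₁ (xs⊆ys (there a∈xs))
  ... | inj₁ a∈ys₁         = ∈-++⁺ˡ a∈ys₁
  ... | inj₂ (here refl)   = ⊥-elim (All.lookup x∉xs a∈xs refl)
  ... | inj₂ (there a∈ys₂) = ∈-++⁺ʳ ys₁ a∈ys₂

Card-mono : {P Q : A → Set} → Card P k → Card Q k′ → ∀[ P ⇒ Q ] → k ≤ k′
Card-mono (xs , !xs , xs⇔P , refl) (ys , _ , ys⇔Q , refl) P⇒Q =
  length-≤-of-unique-⊆ !xs λ {a} a∈xs →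
    Equivalence.from (ys⇔Q a) (P⇒Q (Equivalence.to (xs⇔P a) a∈xs))

Card-functional : {P : A → Set} → Card P k → Card P k′ → k ≡ k′
Card-functional c c′ = ≤-antisym (Card-mono c c′ id) (Card-mono c′ c id)

Card-resp : {P Q : A → Set} → ∀[ P ⇒ Q ] → ∀[ Q ⇒ P ] → Card P k → Card Q k
Card-resp P⇒Q Q⇒P (xs , !xs , xs⇔P , len) =
  xs , !xs , (λ a → mk⇔ (P⇒Q ∘ Equivalence.to (xs⇔P a)) (Equivalence.from (xs⇔P a) ∘ Q⇒P)) , len

Card-of-decidable : {P : A → Set} → DecidableEquality A → (xs : List A) → (∀ a → a ∈ xs) →
  Decidable P → ∃[ k ] Card P k
Card-of-decidable {A = A} _≟_ xs complete P? =
  length witnesses , witnesses , filter⁺ P? (deduplicate-! _≟_ xs) ,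
  (λ a → mk⇔ (proj₂ ∘ ∈-filter⁻ P? {xs = deduplicate _≟_ xs}) (∈-filter⁺ P? (∈-deduplicate⁺ _≟_ (complete a)))) , refl
  where
  witnesses : List A
  witnesses = filter P? (deduplicate _≟_ xs)

∃?-within : {P : A → Set} {xs : List A} → (∀ {a} → P a → a ∈ xs) → Decidable P → Dec (∃ P)
∃?-within {xs = xs} P⊆xs P? =
  map′ Any.satisfied (λ (a , pa) → lose (P⊆xs pa) pa) (Any.any? P? xs)

∀?-within : {P : A → Set} {xs : List A} → (∀ a → a ∈ xs) → Decidable P → Dec (∀ a → P a)
∀?-within {xs = xs} complete P? =
  map′ (λ all a → All.lookup all (complete a)) (λ ∀P → All.tabulate λ {a} _ → ∀P a) (All.all? P? xs)

subsets : List A → List (List A)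
subsets []       = [] ∷ []
subsets (x ∷ xs) = map (x ∷_) (subsets xs) ++ subsets xs

filter∈subsets : {P : A → Set} (P? : Decidable P) (xs : List A) → filter P? xs ∈ subsets xs
filter∈subsets P? []       = here refl
filter∈subsets P? (x ∷ xs) with does (P? x)
... | true  = ∈-++⁺ˡ (∈-map⁺ (x ∷_) (filter∈subsets P? xs))
... | false = ∈-++⁺ʳ (map (x ∷_) (subsets xs)) (filter∈subsets P? xs)

Subgraph : ∀ {n} → Graph n → Graph n → Set
Subgraph G H = ∀ d → G d ≡ true → H d ≡ true

module _ {n : ℕ} where

  open import Data.List.Membership.DecPropositional (_≟ᶠ_ {n}) using (_∈?_)
  open import Data.List.Relation.Unary.Unique.DecPropositional (_≟ᶠ_ {n}) using (unique?)

  edgesBetween : Fin n → Fin n → List (Edge n)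
  edgesBetween s t with s <? t
  ... | yes s<t = edge s t s<t ∷ []
  ... | no _    = []

  ∈-edgesBetween : ∀ {s t} (s<t : s <ᶠ t) → edge s t s<t ∈ edgesBetween s t
  ∈-edgesBetween {s} {t} s<t with s <? t
  ... | yes s<t′ = here (cong (edge s t) (≤-irrelevant s<t s<t′))
  ... | no s≮t   = contradiction s<t s≮t

  edges : List (Edge n)
  edges = concatMap (λ s → concatMap (edgesBetween s) (allFin n)) (allFin n)

  ∈-edges : ∀ d → d ∈ edges
  ∈-edges (edge s t s<t) =
    ∈-concatMap⁺ (λ s → concatMap (edgesBetween s) (allFin n))
      (lose (∈-allFin s) (∈-concatMap⁺ (edgesBetween s) (lose (∈-allFin t) (∈-edgesBetween s<t))))

  vertexLists : ℕ → List (List (Fin n))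
  vertexLists zero    = [] ∷ []
  vertexLists (suc k) = [] ∷ concatMap (λ v → map (v ∷_) (vertexLists k)) (allFin n)

  ∈-vertexLists : ∀ {k} (vs : List (Fin n)) → length vs ≤ k → vs ∈ vertexLists k
  ∈-vertexLists {zero}  []       _         = here refl
  ∈-vertexLists {suc k} []       _         = here refl
  ∈-vertexLists {suc k} (v ∷ vs) (s≤s len) =
    there (∈-concatMap⁺ (λ v → map (v ∷_) (vertexLists k))
      (lose (∈-allFin v) (∈-map⁺ (v ∷_) (∈-vertexLists vs len))))

  unique∈vertexLists : ∀ {vs : List (Fin n)} → Unique vs → vs ∈ vertexLists n
  unique∈vertexLists {vs} !vs = ∈-vertexLists vs
    (subst (length vs ≤_) (length-tabulate id) (length-≤-of-unique-⊆ !vs (λ {v} _ → ∈-allFin v)))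

  ∃?-unique : {R : List (Fin n) → Set} → Decidable R → (∀ {vs} → R vs → Unique vs) → Dec (∃ R)
  ∃?-unique R? R⇒Unique = ∃?-within (unique∈vertexLists ∘ R⇒Unique) R?

  Joins? : ∀ d u v → Dec (Joins {n} d u v)
  Joins? d u v = (src d ≟ᶠ u ×-dec tgt d ≟ᶠ v) ⊎-dec (src d ≟ᶠ v ×-dec tgt d ≟ᶠ u)

  Adj? : ∀ (G : Graph n) u v → Dec (Adj G u v)
  Adj? G u v = ∃?-within (λ {d} _ → ∈-edges d) (λ d → G d ≟ᵇ true ×-dec Joins? d u v)

  walk-singleton : ∀ {G : Graph n} {x y v} → Walk G x y (v ∷ []) → x ≡ v × y ≡ v
  walk-singleton here = refl , refl

  walk-uncons : ∀ {G : Graph n} {x y v w vs} → Walk G x y (v ∷ w ∷ vs) → x ≡ v × Adj G v w × Walk G w y (w ∷ vs)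
  walk-uncons (step v~w here)         = refl , v~w , here
  walk-uncons (step v~w (step w~ w⇝)) = refl , v~w , step w~ w⇝

  Walk? : ∀ (G : Graph n) x y vs → Dec (Walk G x y vs)
  Walk? G x y []                = no λ ()
  Walk? G x y (v ∷ [])          =
    map′ (λ { (refl , refl) → here }) walk-singleton (x ≟ᶠ v ×-dec y ≟ᶠ v)
  Walk? G x y (v ∷ ws@(w ∷ _)) =
    map′ (λ { (refl , v~w , w⇝y) → step v~w w⇝y }) walk-uncons (x ≟ᶠ v ×-dec Adj? G v w ×-dec Walk? G w y ws)

  Path? : ∀ (G : Graph n) x y vs → Dec (Path G x y vs)
  Path? G x y vs = Walk? G x y vs ×-dec unique? vs

  Uses? : ∀ (d : Edge n) vs → Dec (Uses d vs)
  Uses? d []           = no λ ()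
  Uses? d (u ∷ [])     = no λ ()
  Uses? d (u ∷ v ∷ vs) = Joins? d u v ⊎-dec Uses? d (v ∷ vs)

  path-from-∈ : ∀ {G : Graph n} {x y z vs} → Walk G y z vs → Unique vs → x ∈ vs → ∃[ ws ] Path G x z ws
  path-from-∈ here              !vs       (here refl)  = _ , here , !vs
  path-from-∈ (step y~y′ y′⇝z) !vs       (here refl)  = _ , step y~y′ y′⇝z , !vs
  path-from-∈ (step _ y′⇝z)    (_ ∷ !vs) (there x∈vs) = path-from-∈ y′⇝z !vs x∈vs

  -- If x reappears on the path from its successor, cut the walk there.
  walk⇒path : ∀ {G : Graph n} {x y vs} → Walk G x y vs → ∃[ ws ] Path G x y ws
  walk⇒path here = _ , here , [] ∷ []
  walk⇒path {x = x} (step x~x′ x′⇝y) with ws , x′⇝y′ , !ws ← walk⇒path x′⇝y with x ∈? ws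
  ... | yes x∈ws = path-from-∈ x′⇝y′ !ws x∈ws
  ... | no x∉ws  = x ∷ ws , step x~x′ x′⇝y′ , All.tabulate (λ { v∈ws refl → x∉ws v∈ws }) ∷ !ws

  Connected? : ∀ (G : Graph n) → Dec (Connected G)
  Connected? G = Fin.all? λ x → Fin.all? λ y →
    map′ (λ (vs , x⇝y , _) → vs , x⇝y) (walk⇒path ∘ proj₂) (∃?-unique (Path? G x y) proj₂)

  HasCycle? : ∀ (G : Graph n) → Dec (HasCycle G)
  HasCycle? G = Fin.any? λ x → Fin.any? λ y →
    ∃?-unique (λ vs → Path? G x y vs ×-dec 3 ≤? length vs ×-dec Adj? G y x) (proj₂ ∘ proj₁)

  Subgraph? : ∀ (G H : Graph n) → Dec (Subgraph G H)
  Subgraph? G H = ∀?-within ∈-edges λ d → G d ≟ᵇ true →-dec H d ≟ᵇ true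

  SpanningTree? : ∀ (H T : Graph n) → Dec (SpanningTree H T)
  SpanningTree? H T = Subgraph? T H ×-dec Connected? T ×-dec ¬? (HasCycle? T)

  InTreeCycle? : ∀ (T : Graph n) f d → Dec (InTreeCycle T f d)
  InTreeCycle? T f d =
    d ≟ₑ f ⊎-dec ∃?-unique (λ vs → Path? T (src f) (tgt f) vs ×-dec Uses? d vs) (proj₂ ∘ proj₁)

  SharePair? : ∀ (H T : Graph n) → Decidable (SharePair H T)
  SharePair? H T (f , g) =
    CycleEdge? f ×-dec CycleEdge? g ×-dec f <ₑ? g ×-dec
    ∃?-within (λ {d} _ → ∈-edges d) (λ d → InTreeCycle? T f d ×-dec InTreeCycle? T g d)
    where
    CycleEdge? : ∀ f → Dec (CycleEdge H T f)
    CycleEdge? f = H f ≟ᵇ true ×-dec T f ≟ᵇ false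
    _<ₑ?_ : ∀ (d e : Edge n) → Dec (d <ₑ e)
    d <ₑ? e = src d <? src e ⊎-dec (src d ≟ᶠ src e ×-dec tgt d <? tgt e)

  Cap-exists : ∀ (H T : Graph n) → ∃[ k ] Cap H T k
  Cap-exists H T = Card-of-decidable (≡-dec _≟ₑ_ _≟ₑ_) (cartesianProduct edges edges)
    (λ (f , g) → ∈-cartesianProduct⁺ (∈-edges f) (∈-edges g)) (SharePair? H T)

  -- Kept abstract: unification would otherwise unfold cap into a filter over
  -- all pairs of edges, which makes type checking intractable.
  abstract
    cap : Graph n → Graph n → ℕ
    cap H T = proj₁ (Cap-exists H T)

    cap-Cap : ∀ (H T : Graph n) → Cap H T (cap H T)
    cap-Cap H T = proj₂ (Cap-exists H T)

  fromEdges : List (Edge n) → Graph n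
  fromEdges ds d = does (Any.any? (d ≟ₑ_) ds)

  edgesOf : Graph n → List (Edge n)
  edgesOf G = filter (λ d → G d ≟ᵇ true) edges

  ≗-fromEdges-edgesOf : ∀ G → G ≗ fromEdges (edgesOf G)
  ≗-fromEdges-edgesOf G d with Any.any? (d ≟ₑ_) (edgesOf G)
  ... | yes d∈ = proj₂ (∈-filter⁻ (λ d → G d ≟ᵇ true) {xs = edges} d∈)
  ... | no d∉  = ¬-not λ Gd → d∉ (∈-filter⁺ (λ d → G d ≟ᵇ true) (∈-edges d) Gd)

  graphs : List (Graph n)
  graphs = map fromEdges (subsets edges)

  graphs-complete : ∀ G → ∃[ G′ ] (G′ ∈ graphs × G ≗ G′)
  graphs-complete G =
    fromEdges (edgesOf G) , ∈-map⁺ fromEdges (filter∈subsets _ edges) , ≗-fromEdges-edgesOf G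

  module _ {T T′ : Graph n} (T≗T′ : T ≗ T′) where

    Adj-≗ : ∀ {u v} → Adj T u v → Adj T′ u v
    Adj-≗ (d , Td , joins) = d , trans (sym (T≗T′ d)) Td , joins

    Walk-≗ : ∀ {x y vs} → Walk T x y vs → Walk T′ x y vs
    Walk-≗ here          = here
    Walk-≗ (step x~ ⇝y) = step (Adj-≗ x~) (Walk-≗ ⇝y)

    Path-≗ : ∀ {x y vs} → Path T x y vs → Path T′ x y vs
    Path-≗ (x⇝y , !vs) = Walk-≗ x⇝y , !vs

    HasCycle-≗ : HasCycle T → HasCycle T′
    HasCycle-≗ (x , y , vs , x⇝y , len , y~x) = x , y , vs , Path-≗ x⇝y , len , Adj-≗ y~x

    InTreeCycle-≗ : ∀ {f d} → InTreeCycle T f d → InTreeCycle T′ f d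
    InTreeCycle-≗ (inj₁ d≡f)                = inj₁ d≡f
    InTreeCycle-≗ (inj₂ (vs , path , uses)) = inj₂ (vs , Path-≗ path , uses)

    SharePair-≗ : ∀ {H} → ∀[ SharePair H T ⇒ SharePair H T′ ]
    SharePair-≗ {x = f , g} ((Hf , Tf) , (Hg , Tg) , f<g , d , f∋d , g∋d) =
      (Hf , trans (sym (T≗T′ f)) Tf) , (Hg , trans (sym (T≗T′ g)) Tg) , f<g ,
      d , InTreeCycle-≗ f∋d , InTreeCycle-≗ g∋d

  SpanningTree-≗ : ∀ {H T T′ : Graph n} → T ≗ T′ → SpanningTree H T → SpanningTree H T′
  SpanningTree-≗ T≗T′ (T⊆H , connected , acyclic) =
    (λ d T′d → T⊆H d (trans (T≗T′ d) T′d)) ,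
    (λ x y → let (vs , x⇝y) = connected x y in vs , Walk-≗ T≗T′ x⇝y) ,
    acyclic ∘ HasCycle-≗ (sym ∘ T≗T′)

  Cap-≗ : ∀ {H T T′ : Graph n} → T ≗ T′ → Cap H T k → Cap H T′ k
  Cap-≗ {H = H} T≗T′ = Card-resp (SharePair-≗ T≗T′ {H}) (SharePair-≗ (sym ∘ T≗T′) {H})

  MinCap-exists : ∀ {G T : Graph n} {k} → SpanningTree G T → Cap G T k → ∃[ m ] (MinCap G m × m ≤ k)
  MinCap-exists {G} {T} {k} T-spans capT =
    cap G T₀ , ((T₀ , T₀-spans , cap-Cap G T₀) , T₀-minimal) , T₀≤T
    where
    trees : List (Graph n)
    trees = filter (SpanningTree? G) graphs

    T₀ : Graph n
    T₀ = argmin (cap G) T trees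

    T₀-spans : SpanningTree G T₀
    T₀-spans = argmin-all (cap G) {P = SpanningTree G} T-spans (all-filter (SpanningTree? G) graphs)

    T₀≤T : cap G T₀ ≤ k
    T₀≤T = subst (cap G T₀ ≤_) (Card-functional (cap-Cap G T) capT) (f[argmin]≤f[⊤] {f = cap G} T trees)

    T₀-minimal : ∀ T′ k′ → SpanningTree G T′ → Cap G T′ k′ → cap G T₀ ≤ k′
    T₀-minimal T′ k′ T′-spans capT′ with T″ , T″∈graphs , T′≗T″ ← graphs-complete T′ =
      subst (cap G T₀ ≤_) (Card-functional (cap-Cap G T″) (Cap-≗ T′≗T″ capT′))
        (All.lookup (f[argmin]≤f[xs] {f = cap G} T trees)
          (∈-filter⁺ (SpanningTree? G) T″∈graphs (SpanningTree-≗ T′≗T″ T′-spans)))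

  ─-subgraph : ∀ (H : Graph n) e → Subgraph (H ─ e) H
  ─-subgraph H e d with H d
  ... | true  = λ _ → refl
  ... | false = λ ()

  subgraph-─ : ∀ {T H : Graph n} {e} → Subgraph T H → T e ≡ false → Subgraph T (H ─ e)
  subgraph-─ {e = e} T⊆H Te d Td with d ≟ₑ e
  ... | yes refl = contradiction (trans (sym Td) Te) λ ()
  ... | no _     = cong (_∧ true) (T⊆H d Td)

  Cap-mono-subgraph : ∀ {G H T : Graph n} {k k′} → Subgraph G H → Cap G T k → Cap H T k′ → k ≤ k′
  Cap-mono-subgraph G⊆H capG capH = Card-mono capG capH
    λ { {f , g} ((Gf , Tf) , (Gg , Tg) , rest) → (G⊆H f Gf , Tf) , (G⊆H g Gg , Tg) , rest }

lemma15 : ∀ {n} (H : Graph n) → Connected H → (T : Graph n) → IsSolution H T →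
    ∀ (e : Edge n) → H e ≡ true → T e ≡ false →
    ∃[ mG ] ∃[ mH ] (MinCap (H ─ e) mG × MinCap H mH × mG ≤ mH)
lemma15 H _ T (T-spans@(T⊆H , connected , acyclic) , c , capT , c-minimal) e _ Te
  with m , minG , m≤k ← MinCap-exists (subgraph-─ T⊆H Te , connected , acyclic) (cap-Cap (H ─ e) T) =
  m , c , minG , ((T , T-spans , capT) , c-minimal) ,
  ≤-trans m≤k (Cap-mono-subgraph (─-subgraph H e) (cap-Cap (H ─ e) T) capT)
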